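{- Let $F$ be an $r$-graph, $i\in[r-1]$, and $S^\ast\in\binom{V(F)}{i}$ such that $F(S^\ast)$ is non-empty. Let $G$ be a complex, let $S_1,S_2\in\binom{V(G)}{i}$ be disjoint, and let $\phi:S_1\to S_2$ be a bijection. Suppose that $L\subseteq G(S_1)^{(r-i)}\cap G(S_2)^{(r-i)}$ and that $\mathcal{F}'$ is a $\kappa$-well separated $F(S^\ast)$-decomposition of $(G(S_1)\cap G(S_2))[L]$. Let $(\mathcal{F}_1,\mathcal{F}_2)=S_1\triangleleft\mathcal{F}'\triangleright S_2$. Then: (i) for $j\in\{1,2\}$, $\mathcal{F}_j$ is a $\kappa$-well separated $F$-packing in $G$ with $\{e\in\mathcal{F}_j^{(r)}:S_j\subseteq e\}=S_j\uplus L$; (ii) $V(\mathcal{F}_1^{(r)})\subseteq V(G)\setminus S_2$ and $\phi(\mathcal{F}_1^{(r)})=\mathcal{F}_2^{(r)}$.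
   Context: For a $k$-graph $H$ and $S\subseteq V(H)$, $H(S)$ is the $(k-|S|)$-graph on $V(H)\setminus S$ of all $e$ with $S\cup e\in H$. A complex is a hypergraph closed under subsets; $G^{(j)}$ is its $j$-graph; $G(S)$ is the complex on $V(G)\setminus S$ of all $e$ with $S\cup e\in G$; for complexes $G_1,G_2$, $G_1\cap G_2$ is the complex on $V(G_1)\cap V(G_2)$ of sets in both; for a complex $G'$ and $k$-graph $L$, $G'[L]$ consists of all $e\in G'$ with $\binom{e}{k}\subseteq L$. For a $k$-graph $F_0$ on $f_0$ vertices, an $F_0$-packing in a complex $G'$ is a set of edge-disjoint copies $F'$ of $F_0$ in $G'^{(k)}$ with $V(F')\in G'^{(f_0)}$; an $F_0$-decomposition additionally covers all of $G'^{(k)}$. Such a packing is $\kappa$-well separated if any two distinct members share at most $k$ vertices and every $k$-set lies in the vertex set of at most $\kappa$ members (well separated: only the first condition). The map $\phi$ is extended to sets $X\subseteq V(G)\setminus S_2$ by $\phi(X):=(X\setminus S_1)\cup\phi(X\cap S_1)$, and to $r$-graphs $R$ with $V(R)\subseteq V(G)\setminus S_2$ by letting $\phi(R)$ be the $r$-graph on $\phi(V(R))$ with edges $\phi(e)$, $e\in R$. For a well separated $F(S^\ast)$-packing $\mathcal{F}'$ in $G(S_1)\cap G(S_2)$, $S_1\triangleleft\mathcal{F}'\triangleright S_2:=(\mathcal{F}_1,\mathcal{F}_2)$ where $\mathcal{F}_j=\{F'_j:F'\in\mathcal{F}'\}$ and for each $F'\in\mathcal{F}'$, $F'_j$ is a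 copy of $F$ on vertex set $S_j\cup V(F')$ with $F'_j(S_j)=F'$, chosen such that $\phi(F'_1)=F'_2$. $\mathcal{F}_j^{(r)}$ is the union of the edge sets of members of $\mathcal{F}_j$, and $S\uplus L:=\{S\cup e:e\in L\}$. -}

module Defs where

open import Data.Nat using (ℕ; suc; _≤_; _∸_)
open import Data.Fin using (Fin)
open import Data.Fin.Subset
  using (Subset; _∈_; _∉_; _⊆_; _∩_; _∪_; _─_; ⋃; ∣_∣)
open import Data.List using (map; allFin)
open import Data.Product using (Σ; ∃; _×_; _,_)
open import Data.Sum using (_⊎_)
open import Data.Empty using (⊥)
open import Relation.Nullary using (¬_)
open import Relation.Binary.PropositionalEquality using (_≡_; _≢_)
open import Function using (_∘_; _⇔_)

record HG (n : ℕ) : Set₁ where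
  constructor mkHG
  field
    V : Subset n
    E : Subset n → Set
open HG public

IsHypergraph : ∀ {n} → HG n → Set
IsHypergraph H = ∀ e → E H e → e ⊆ V H

IsKGraph : ∀ {n} → ℕ → HG n → Set
IsKGraph k H = IsHypergraph H × (∀ e → E H e → ∣ e ∣ ≡ k)

IsComplex : ∀ {n} → HG n → Set
IsComplex G = IsHypergraph G × (∀ e e′ → E G e → e′ ⊆ e → E G e′)

_≈H_ : ∀ {n} → HG n → HG n → Set
H ≈H H′ = (V H ≡ V H′) × (∀ e → E H e ⇔ E H′ e)

level : ∀ {n} → ℕ → HG n → HG n
level j G = mkHG (V G) (λ e → E G e × ∣ e ∣ ≡ j)

link : ∀ {n} → HG n → Subset n → HG n
link H S = mkHG (V H ─ S) (λ e → (e ⊆ (V H ─ S)) × E H (S ∪ e))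

_∩G_ : ∀ {n} → HG n → HG n → HG n
G₁ ∩G G₂ = mkHG (V G₁ ∩ V G₂) (λ e → E G₁ e × E G₂ e)

-- G′[L] for a complex G′ and a k-graph L (given by its edge set)
restrict : ∀ {n} → ℕ → HG n → (Subset n → Set) → HG n
restrict k G L =
  mkHG (V G) (λ e → E G e × (∀ e′ → e′ ⊆ e → ∣ e′ ∣ ≡ k → L e′))

IsImage : ∀ {m n} → (Fin m → Fin n) → Subset m → Subset n → Set
IsImage σ e e′ = ∀ y → y ∈ e′ ⇔ (∃ λ x → x ∈ e × σ x ≡ y)

IsCopy : ∀ {m n} → HG m → HG n → Set
IsCopy F H = Σ (_ → _) λ σ →
  (∀ x y → x ∈ V F → y ∈ V F → σ x ≡ σ y → x ≡ y) ×
  IsImage σ (V F) (V H) ×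
  (∀ e → E H e ⇔ (∃ λ e₀ → E F e₀ × IsImage σ e₀ e))

-- Packings. A collection of copies is represented as a family indexed
-- by Fin p; "distinct members" means distinct indices.

AtMost : ∀ {p} → ℕ → (Fin p → Set) → Set
AtMost {p} κ P =
  (g : Fin (suc κ) → Fin p) → (∀ a b → g a ≡ g b → a ≡ b) → ¬ (∀ a → P (g a))

IsPacking : ∀ {m n p} → ℕ → HG m → HG n → (Fin p → HG n) → Set
IsPacking {m} k F₀ G′ 𝓕 =
  (∀ q → IsCopy F₀ (𝓕 q)) ×
  (∀ q e → E (𝓕 q) e → E (level k G′) e) ×
  (∀ q → E (level ∣ V F₀ ∣ G′) (V (𝓕 q))) ×
  (∀ q q′ e → q ≢ q′ → E (𝓕 q) e → E (𝓕 q′) e → ⊥)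

IsDecomposition : ∀ {m n p} → ℕ → HG m → HG n → (Fin p → HG n) → Set
IsDecomposition k F₀ G′ 𝓕 =
  IsPacking k F₀ G′ 𝓕 × (∀ e → E (level k G′) e → ∃ λ q → E (𝓕 q) e)

WellSep : ∀ {n p} → ℕ → (Fin p → HG n) → Set
WellSep k 𝓕 = ∀ q q′ → q ≢ q′ → ∣ V (𝓕 q) ∩ V (𝓕 q′) ∣ ≤ k

KWellSep : ∀ {n p} → ℕ → ℕ → (Fin p → HG n) → Set
KWellSep κ k 𝓕 =
  WellSep k 𝓕 × (∀ e → ∣ e ∣ ≡ k → AtMost κ (λ q → e ⊆ V (𝓕 q)))

-- The bijection φ : S₁ → S₂, given as a function on Fin n of which only
-- the values on S₁ matter.
IsBijOn : ∀ {n} → Subset n → Subset n → (Fin n → Fin n) → Set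
IsBijOn S₁ S₂ φ =
  (∀ x → x ∈ S₁ → φ x ∈ S₂) ×
  (∀ x y → x ∈ S₁ → y ∈ S₁ → φ x ≡ φ y → x ≡ y) ×
  (∀ y → y ∈ S₂ → ∃ λ x → x ∈ S₁ × φ x ≡ y)

IsPhiSet : ∀ {n} → Subset n → (Fin n → Fin n) → Subset n → Subset n → Set
IsPhiSet S₁ φ X Y =
  ∀ y → y ∈ Y ⇔ ((y ∈ X × y ∉ S₁) ⊎ (∃ λ x → x ∈ X × x ∈ S₁ × φ x ≡ y))

IsPhiGraph : ∀ {n} → Subset n → (Fin n → Fin n) → HG n → HG n → Set
IsPhiGraph S₁ φ R H =
  IsPhiSet S₁ φ (V R) (V H) ×
  (∀ e → E H e ⇔ (∃ λ e′ → E R e′ × IsPhiSet S₁ φ e′ e))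

unionG : ∀ {n p} → (Fin p → HG n) → HG n
unionG {p = p} 𝓕 = mkHG (⋃ (map (V ∘ 𝓕) (allFin p))) (λ e → ∃ λ q → E (𝓕 q) e)

-- (𝓕₁ , 𝓕₂) = S₁ ◁ 𝓕′ ▷ S₂ (for given choices of the copies)
IsTriangle : ∀ {m n p} → HG m → Subset n → Subset n → (Fin n → Fin n) →
             (Fin p → HG n) → (Fin p → HG n) → (Fin p → HG n) → Set
IsTriangle F S₁ S₂ φ 𝓕′ 𝓕₁ 𝓕₂ = ∀ q →
  (IsCopy F (𝓕₁ q) × V (𝓕₁ q) ≡ S₁ ∪ V (𝓕′ q) × link (𝓕₁ q) S₁ ≈H 𝓕′ q) ×
  (IsCopy F (𝓕₂ q) × V (𝓕₂ q) ≡ S₂ ∪ V (𝓕′ q) × link (𝓕₂ q) S₂ ≈H 𝓕′ q) ×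
  IsPhiGraph S₁ φ (𝓕₁ q) (𝓕₂ q)

_⊎L_ : ∀ {n} → Subset n → (Subset n → Set) → Subset n → Set
(S ⊎L L) e = ∃ λ e′ → L e′ × e ≡ S ∪ e′

-- A member of 𝓕ⱼ is a member F′ of 𝓕′ with Sⱼ added. Two members built from
-- F′ and F″ meet inside Sⱼ ∪ (V(F′) ∩ V(F″)), a set of at most i + (r − i) = r
-- vertices. This gives well separation, and forces an edge shared by the two
-- members to be that whole set; it then contains Sⱼ, and removing Sⱼ would give
-- an edge shared by F′ and F″. Similarly, κ + 1 members of 𝓕ⱼ containing an
-- r-set e would give κ + 1 members of 𝓕′ containing an (r − i)-subset of e ∖ Sⱼ.
-- The edges of 𝓕ⱼ through Sⱼ are Sⱼ plus an edge of 𝓕′, and these edges are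
-- exactly L because 𝓕′ decomposes (G(S₁) ∩ G(S₂))[L]. Part (ii) is the union over all
-- members of φ(F′₁) = F′₂.
module Submission where

open import Defs
open import Data.Nat using (ℕ; zero; suc; _≤_; _<_; _∸_; _+_; z≤n; s≤s)
open import Data.Nat.Properties
  using (≤-trans; ≤-reflexive; ≤-pred; +-mono-≤; +-monoʳ-≤; +-suc; n≤1+n;
         <⇒≤; <⇒≱; m+[n∸m]≡n; m≤n+o⇒m∸n≤o; suc-injective; module ≤-Reasoning)
open import Data.Fin using (Fin; zero; suc)
open import Data.Fin.Subset renaming (⊥ to ∅)
open import Data.Fin.Subset.Properties
open import Data.Vec using ([]; _∷_; here; there)
open import Data.List using (List; map; allFin) renaming ([] to []ₗ; _∷_ to _∷ₗ_)
open import Data.List.Membership.Propositional using () renaming (_∈_ to _∈ₗ_)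
open import Data.List.Membership.Propositional.Properties using (∈-allFin)
open import Data.List.Relation.Unary.Any using (here; there)
open import Data.Product using (∃; _×_; _,_; proj₁; proj₂)
open import Data.Sum using (_⊎_; inj₁; inj₂)
open import Data.Empty using (⊥; ⊥-elim)
open import Relation.Nullary using (yes; no)
open import Relation.Binary.PropositionalEquality
open import Function using (_∘_; _⇔_; mk⇔; Equivalence)
open Equivalence

private variable
  m n p : ℕ
  x y : Fin n

x∈p─q⇒x∉q : ∀ (p q : Subset n) → x ∈ p ─ q → x ∉ q
x∈p─q⇒x∉q (s ∷ p) (outside ∷ q) (there x∈) (there x∈q) = x∈p─q⇒x∉q p q x∈ x∈q
x∈p─q⇒x∉q (s ∷ p) (inside ∷ q) (there x∈) (there x∈q) = x∈p─q⇒x∉q p q x∈ x∈q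

x∈p-y⇒x≢y : ∀ (p : Subset n) → x ∈ p - y → x ≢ y
x∈p-y⇒x≢y {y = y} p x∈ = x∉⁅y⁆⇒x≢y (x∈p─q⇒x∉q p ⁅ y ⁆ x∈)

q⊆p∪[q─p] : ∀ (p q : Subset n) → q ⊆ p ∪ (q ─ p)
q⊆p∪[q─p] p q {x} x∈q with x ∈? p
... | yes x∈p = x∈p∪q⁺ (inj₁ x∈p)
... | no x∉p = x∈p∪q⁺ (inj₂ (x∈p∧x∉q⇒x∈p─q x∈q x∉p))

p⊆q⇒p∪[q─p]≡q : ∀ {p q : Subset n} → p ⊆ q → p ∪ (q ─ p) ≡ q
p⊆q⇒p∪[q─p]≡q {p = p} {q} p⊆q = ⊆-antisym ∪⊆q (q⊆p∪[q─p] p q)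
  where
  ∪⊆q : p ∪ (q ─ p) ⊆ q
  ∪⊆q x∈ with x∈p∪q⁻ p (q ─ p) x∈
  ... | inj₁ x∈p = p⊆q x∈p
  ... | inj₂ x∈q─p = p─q⊆p q p x∈q─p

∣p∪q∣≤∣p∣+∣q∣ : ∀ (p q : Subset n) → ∣ p ∪ q ∣ ≤ ∣ p ∣ + ∣ q ∣
∣p∪q∣≤∣p∣+∣q∣ [] [] = z≤n
∣p∪q∣≤∣p∣+∣q∣ (inside ∷ p) (inside ∷ q) =
  s≤s (≤-trans (∣p∪q∣≤∣p∣+∣q∣ p q) (+-monoʳ-≤ ∣ p ∣ (n≤1+n ∣ q ∣)))
∣p∪q∣≤∣p∣+∣q∣ (inside ∷ p) (outside ∷ q) = s≤s (∣p∪q∣≤∣p∣+∣q∣ p q)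
∣p∪q∣≤∣p∣+∣q∣ (outside ∷ p) (inside ∷ q) =
  ≤-trans (s≤s (∣p∪q∣≤∣p∣+∣q∣ p q)) (≤-reflexive (sym (+-suc ∣ p ∣ ∣ q ∣)))
∣p∪q∣≤∣p∣+∣q∣ (outside ∷ p) (outside ∷ q) = ∣p∪q∣≤∣p∣+∣q∣ p q

p⊆q∧∣q∣≤∣p∣⇒q⊆p : ∀ {p q : Subset n} → p ⊆ q → ∣ q ∣ ≤ ∣ p ∣ → q ⊆ p
p⊆q∧∣q∣≤∣p∣⇒q⊆p {p = []} {[]} _ _ ()
p⊆q∧∣q∣≤∣p∣⇒q⊆p {p = inside ∷ p} {inside ∷ q} p⊆q le =
  in⊆in (p⊆q∧∣q∣≤∣p∣⇒q⊆p (drop-∷-⊆ p⊆q) (≤-pred le))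
p⊆q∧∣q∣≤∣p∣⇒q⊆p {p = outside ∷ p} {outside ∷ q} p⊆q le =
  s⊆s (p⊆q∧∣q∣≤∣p∣⇒q⊆p (drop-∷-⊆ p⊆q) le)
p⊆q∧∣q∣≤∣p∣⇒q⊆p {p = inside ∷ p} {outside ∷ q} p⊆q le with p⊆q here
... | ()
p⊆q∧∣q∣≤∣p∣⇒q⊆p {p = outside ∷ p} {inside ∷ q} p⊆q le =
  ⊥-elim (<⇒≱ (s≤s (p⊆q⇒∣p∣≤∣q∣ (drop-∷-⊆ p⊆q))) le)

subset-of-size : ∀ k (p : Subset n) → k ≤ ∣ p ∣ → ∃ λ b → b ⊆ p × ∣ b ∣ ≡ k
subset-of-size {n} zero p _ = ∅ , (λ x∈⊥ → ⊥-elim (∉⊥ x∈⊥)) , ∣⊥∣≡0 n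
subset-of-size (suc k) (inside ∷ p) (s≤s k≤∣p∣) with subset-of-size k p k≤∣p∣
... | b , b⊆p , ∣b∣≡k = inside ∷ b , in⊆in b⊆p , cong suc ∣b∣≡k
subset-of-size (suc k) (outside ∷ p) k≤∣p∣ with subset-of-size (suc k) p k≤∣p∣
... | b , b⊆p , ∣b∣≡k = outside ∷ b , out⊆ b⊆p , ∣b∣≡k

∣p∣≡0⇒x∉p : ∀ (p : Subset n) → ∣ p ∣ ≡ 0 → x ∉ p
∣p∣≡0⇒x∉p (inside ∷ p) () _
∣p∣≡0⇒x∉p (outside ∷ p) ∣p∣≡0 (there x∈p) = ∣p∣≡0⇒x∉p p ∣p∣≡0 x∈p

∣p∣≡suc⇒Nonempty : ∀ (p : Subset n) {c} → ∣ p ∣ ≡ suc c → Nonempty p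
∣p∣≡suc⇒Nonempty (inside ∷ p) _ = zero , here
∣p∣≡suc⇒Nonempty (outside ∷ p) ∣p∣≡1+c with ∣p∣≡suc⇒Nonempty p ∣p∣≡1+c
... | x , x∈p = suc x , there x∈p

Empty⇒∣p∣≡0 : ∀ {p : Subset n} → Empty p → ∣ p ∣ ≡ 0
Empty⇒∣p∣≡0 {n} empty rewrite Empty-unique empty = ∣⊥∣≡0 n

x∈p⇒1+∣p-x∣≡∣p∣ : ∀ (p : Subset n) → x ∈ p → suc ∣ p - x ∣ ≡ ∣ p ∣
x∈p⇒1+∣p-x∣≡∣p∣ (inside ∷ p) here = cong suc (cong ∣_∣ (p─⊥≡p p))
x∈p⇒1+∣p-x∣≡∣p∣ (inside ∷ p) (there x∈p) = cong suc (x∈p⇒1+∣p-x∣≡∣p∣ p x∈p)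
x∈p⇒1+∣p-x∣≡∣p∣ (outside ∷ p) (there x∈p) = x∈p⇒1+∣p-x∣≡∣p∣ p x∈p

∈⋃-map⁻ : ∀ {A : Set} (f : A → Subset n) (as : List A) →
          x ∈ ⋃ (map f as) → ∃ λ a → x ∈ f a
∈⋃-map⁻ f []ₗ x∈ = ⊥-elim (∉⊥ x∈)
∈⋃-map⁻ f (a ∷ₗ as) x∈ with x∈p∪q⁻ (f a) _ x∈
... | inj₁ x∈fa = a , x∈fa
... | inj₂ x∈rest = ∈⋃-map⁻ f as x∈rest

∈⋃-map⁺ : ∀ {A : Set} (f : A → Subset n) {as : List A} {a} →
          a ∈ₗ as → x ∈ f a → x ∈ ⋃ (map f as)
∈⋃-map⁺ f (here refl) x∈fa = x∈p∪q⁺ (inj₁ x∈fa)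
∈⋃-map⁺ f (there a∈) x∈fa = x∈p∪q⁺ (inj₂ (∈⋃-map⁺ f a∈ x∈fa))

InjectiveOn : ∀ {m n} → (Fin m → Fin n) → Subset m → Set
InjectiveOn σ A = ∀ x y → x ∈ A → y ∈ A → σ x ≡ σ y → x ≡ y

IsImage-remove : ∀ {σ : Fin m → Fin n} {e₀ e} → InjectiveOn σ e₀ → x ∈ e₀ →
                 IsImage σ e₀ e → IsImage σ (e₀ - x) (e - σ x)
IsImage-remove {x = x} {σ} {e₀} {e} inj x∈e₀ im y = mk⇔ preimage image
  where
  preimage : y ∈ e - σ x → ∃ λ x′ → x′ ∈ e₀ - x × σ x′ ≡ y
  preimage y∈ with to (im y) (p─q⊆p e ⁅ σ x ⁆ y∈)
  ... | x′ , x′∈e₀ , refl =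
    x′ , x∈p∧x≢y⇒x∈p-y x′∈e₀ (λ { refl → x∈p-y⇒x≢y e y∈ refl }) , refl
  image : (∃ λ x′ → x′ ∈ e₀ - x × σ x′ ≡ y) → y ∈ e - σ x
  image (x′ , x′∈ , refl) =
    x∈p∧x≢y⇒x∈p-y (from (im (σ x′)) (x′ , x′∈e₀ , refl))
                  (x∈p-y⇒x≢y e₀ x′∈ ∘ inj x′ x x′∈e₀ x∈e₀)
    where
    x′∈e₀ : x′ ∈ e₀
    x′∈e₀ = p─q⊆p e₀ ⁅ x ⁆ x′∈

IsImage-size : ∀ {σ : Fin m → Fin n} {e₀ e} →
               InjectiveOn σ e₀ → IsImage σ e₀ e → ∣ e ∣ ≡ ∣ e₀ ∣
IsImage-size {σ = σ} inj im = go _ refl inj im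
  where
  go : ∀ c {e₀ e} → ∣ e₀ ∣ ≡ c → InjectiveOn σ e₀ → IsImage σ e₀ e → ∣ e ∣ ≡ c
  go zero {e₀} ∣e₀∣≡0 _ im =
    Empty⇒∣p∣≡0 λ (y , y∈e) → ∣p∣≡0⇒x∉p e₀ ∣e₀∣≡0 (proj₁ (proj₂ (to (im y) y∈e)))
  go (suc c) {e₀} {e} ∣e₀∣≡1+c inj im with ∣p∣≡suc⇒Nonempty e₀ ∣e₀∣≡1+c
  ... | x₀ , x₀∈e₀ = begin
    ∣ e ∣              ≡⟨ sym (x∈p⇒1+∣p-x∣≡∣p∣ e (from (im (σ x₀)) (x₀ , x₀∈e₀ , refl))) ⟩
    suc ∣ e - σ x₀ ∣   ≡⟨ cong suc (go c ∣e₀-x₀∣≡c inj-x₀ (IsImage-remove inj x₀∈e₀ im)) ⟩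
    suc c              ∎
    where
    open ≡-Reasoning
    ∣e₀-x₀∣≡c : ∣ e₀ - x₀ ∣ ≡ c
    ∣e₀-x₀∣≡c = suc-injective (trans (x∈p⇒1+∣p-x∣≡∣p∣ e₀ x₀∈e₀) ∣e₀∣≡1+c)
    inj-x₀ : InjectiveOn σ (e₀ - x₀)
    inj-x₀ a b a∈ b∈ = inj a b (p─q⊆p e₀ ⁅ x₀ ⁆ a∈) (p─q⊆p e₀ ⁅ x₀ ⁆ b∈)

IsCopy-∣V∣ : ∀ {F : HG m} {H : HG n} → IsCopy F H → ∣ V H ∣ ≡ ∣ V F ∣
IsCopy-∣V∣ (σ , σ-inj , σ-V , _) = IsImage-size σ-inj σ-V

IsCopy-IsKGraph : ∀ {r} {F : HG m} {H : HG n} → IsCopy F H → IsKGraph r F → IsKGraph r H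
IsCopy-IsKGraph {r = r} {F} {H} (σ , σ-inj , σ-V , σ-E) (F-edge⊆V , F-edge-size) =
  edge⊆V , edge-size
  where
  edge⊆V : ∀ e → E H e → e ⊆ V H
  edge⊆V e e∈H {y} y∈e with to (σ-E e) e∈H
  ... | e₀ , e₀∈F , im with to (im y) y∈e
  ...   | x , x∈e₀ , σx≡y = from (σ-V y) (x , F-edge⊆V e₀ e₀∈F x∈e₀ , σx≡y)
  edge-size : ∀ e → E H e → ∣ e ∣ ≡ r
  edge-size e e∈H with to (σ-E e) e∈H
  ... | e₀ , e₀∈F , im = trans (IsImage-size inj-e₀ im) (F-edge-size e₀ e₀∈F)
    where
    inj-e₀ : InjectiveOn σ e₀
    inj-e₀ a b a∈ b∈ = σ-inj a b (F-edge⊆V e₀ e₀∈F a∈) (F-edge⊆V e₀ e₀∈F b∈)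

Extends : HG m → Subset n → (Fin p → HG n) → (Fin p → HG n) → Set
Extends F S 𝓕′ 𝓕 =
  ∀ q → IsCopy F (𝓕 q) × V (𝓕 q) ≡ S ∪ V (𝓕′ q) × link (𝓕 q) S ≈H 𝓕′ q

module Extension
  {m m₀ n p} {r i κ : ℕ} {F : HG m} {F₀ : HG m₀} {G G′ : HG n}
  {L : Subset n → Set} {S : Subset n} {𝓕′ 𝓕 : Fin p → HG n}
  (F-graph : IsKGraph r F) (i<r : i < r) (G-complex : IsComplex G)
  (∣S∣≡i : ∣ S ∣ ≡ i)
  (G′⊆link : ∀ e → E G′ e → E (link G S) e)
  (L⊆G′ : ∀ e → L e → E G′ e × ∣ e ∣ ≡ r ∸ i)
  (decomposition : IsDecomposition (r ∸ i) F₀ (restrict (r ∸ i) G′ L) 𝓕′)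
  (separated : KWellSep κ (r ∸ i) 𝓕′)
  (extends : Extends F S 𝓕′ 𝓕)
  where

  private
    k : ℕ
    k = r ∸ i
    packing′ : IsPacking k F₀ (restrict k G′ L) 𝓕′
    packing′ = proj₁ decomposition

  V-extends : ∀ q → V (𝓕 q) ≡ S ∪ V (𝓕′ q)
  V-extends q = proj₁ (proj₂ (extends q))

  V′∈G′ : ∀ q → E G′ (V (𝓕′ q))
  V′∈G′ q = proj₁ (proj₁ (proj₁ (proj₂ (proj₂ packing′)) q))

  V∈G : ∀ q → E G (V (𝓕 q))
  V∈G q = subst (E G) (sym (V-extends q)) (proj₂ (G′⊆link _ (V′∈G′ q)))

  link-edges : ∀ q e → E (link (𝓕 q) S) e ⇔ E (𝓕′ q) e
  link-edges q = proj₂ (proj₂ (proj₂ (extends q)))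

  edges : ∀ q → IsKGraph r (𝓕 q)
  edges q = IsCopy-IsKGraph (proj₁ (extends q)) F-graph

  edge─S : ∀ q e → E (𝓕 q) e → S ⊆ e → E (𝓕′ q) (e ─ S)
  edge─S q e e∈ S⊆e = to (link-edges q (e ─ S))
    ( (λ y∈ → x∈p∧x∉q⇒x∈p─q (proj₁ (edges q) e e∈ (p─q⊆p e S y∈)) (x∈p─q⇒x∉q e S y∈))
    , subst (E (𝓕 q)) (sym (p⊆q⇒p∪[q─p]≡q S⊆e)) e∈ )

  V─S⊆V′ : ∀ q {e} → e ⊆ V (𝓕 q) → e ─ S ⊆ V (𝓕′ q)
  V─S⊆V′ q {e} e⊆ y∈ with x∈p∪q⁻ S _ (⊆-reflexive (V-extends q) (e⊆ (p─q⊆p e S y∈)))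
  ... | inj₁ y∈S = ⊥-elim (x∈p─q⇒x∉q e S y∈ y∈S)
  ... | inj₂ y∈V′ = y∈V′

  overlap⊆ : ∀ q q′ → V (𝓕 q) ∩ V (𝓕 q′) ⊆ S ∪ (V (𝓕′ q) ∩ V (𝓕′ q′))
  overlap⊆ q q′ {y} y∈ with x∈p∩q⁻ (V (𝓕 q)) _ y∈
  ... | y∈q , y∈q′ with y ∈? S
  ...   | yes y∈S = x∈p∪q⁺ (inj₁ y∈S)
  ...   | no y∉S = x∈p∪q⁺ (inj₂ (x∈p∩q⁺ (on-V′ q y∈q , on-V′ q′ y∈q′)))
    where
    on-V′ : ∀ q → y ∈ V (𝓕 q) → y ∈ V (𝓕′ q)
    on-V′ q y∈ = V─S⊆V′ q ⊆-refl (x∈p∧x∉q⇒x∈p─q y∈ y∉S)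

  overlap-size : ∀ q q′ → q ≢ q′ → ∣ S ∪ (V (𝓕′ q) ∩ V (𝓕′ q′)) ∣ ≤ r
  overlap-size q q′ q≢q′ = begin
    ∣ S ∪ (V (𝓕′ q) ∩ V (𝓕′ q′)) ∣    ≤⟨ ∣p∪q∣≤∣p∣+∣q∣ S _ ⟩
    ∣ S ∣ + ∣ V (𝓕′ q) ∩ V (𝓕′ q′) ∣  ≤⟨ +-mono-≤ (≤-reflexive ∣S∣≡i)
                                                   (proj₁ separated q q′ q≢q′) ⟩
    i + k                              ≡⟨ m+[n∸m]≡n (<⇒≤ i<r) ⟩
    r                                  ∎
    where open ≤-Reasoning

  edge-disjoint : ∀ q q′ e → q ≢ q′ → E (𝓕 q) e → E (𝓕 q′) e → ⊥
  edge-disjoint q q′ e q≢q′ e∈q e∈q′ =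
    proj₂ (proj₂ (proj₂ packing′)) q q′ (e ─ S) q≢q′
      (edge─S q e e∈q S⊆e) (edge─S q′ e e∈q′ S⊆e)
    where
    e⊆overlap : e ⊆ S ∪ (V (𝓕′ q) ∩ V (𝓕′ q′))
    e⊆overlap y∈ =
      overlap⊆ q q′ (x∈p∩q⁺ (proj₁ (edges q) e e∈q y∈ , proj₁ (edges q′) e e∈q′ y∈))
    -- e has r vertices and the overlap at most r, so e is the whole overlap
    overlap⊆e : S ∪ (V (𝓕′ q) ∩ V (𝓕′ q′)) ⊆ e
    overlap⊆e = p⊆q∧∣q∣≤∣p∣⇒q⊆p e⊆overlap
      (≤-trans (overlap-size q q′ q≢q′) (≤-reflexive (sym (proj₂ (edges q) e e∈q))))
    S⊆e : S ⊆ e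
    S⊆e y∈S = overlap⊆e (x∈p∪q⁺ (inj₁ y∈S))

  packing : IsPacking r F G 𝓕
  packing = (λ q → proj₁ (extends q))
          , (λ q e e∈ → proj₂ G-complex _ e (V∈G q) (proj₁ (edges q) e e∈)
                      , proj₂ (edges q) e e∈)
          , (λ q → V∈G q , IsCopy-∣V∣ (proj₁ (extends q)))
          , edge-disjoint

  ∣e─S∣≥k : ∀ e → ∣ e ∣ ≡ r → k ≤ ∣ e ─ S ∣
  ∣e─S∣≥k e ∣e∣≡r = m≤n+o⇒m∸n≤o r i (begin
    r                   ≡⟨ sym ∣e∣≡r ⟩
    ∣ e ∣               ≤⟨ p⊆q⇒∣p∣≤∣q∣ (q⊆p∪[q─p] S e) ⟩
    ∣ S ∪ (e ─ S) ∣     ≤⟨ ∣p∪q∣≤∣p∣+∣q∣ S (e ─ S) ⟩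
    ∣ S ∣ + ∣ e ─ S ∣   ≡⟨ cong (_+ ∣ e ─ S ∣) ∣S∣≡i ⟩
    i + ∣ e ─ S ∣       ∎)
    where open ≤-Reasoning

  covering-multiplicity : ∀ e → ∣ e ∣ ≡ r → AtMost κ (λ q → e ⊆ V (𝓕 q))
  covering-multiplicity e ∣e∣≡r g g-inj covered
    with subset-of-size k (e ─ S) (∣e─S∣≥k e ∣e∣≡r)
  ... | b , b⊆e─S , ∣b∣≡k =
    proj₂ separated b ∣b∣≡k g g-inj (λ a → ⊆-trans b⊆e─S (V─S⊆V′ (g a) (covered a)))

  k-well-separated : KWellSep κ r 𝓕
  k-well-separated =
      (λ q q′ q≢q′ → ≤-trans (p⊆q⇒∣p∣≤∣q∣ (overlap⊆ q q′)) (overlap-size q q′ q≢q′))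
    , covering-multiplicity

  L-covered : ∀ e → L e → ∃ λ q → E (𝓕′ q) e
  L-covered e e∈L =
    proj₂ decomposition e ((proj₁ (L⊆G′ e e∈L) , L-downward) , proj₂ (L⊆G′ e e∈L))
    where
    L-downward : ∀ e′ → e′ ⊆ e → ∣ e′ ∣ ≡ k → L e′
    L-downward e′ e′⊆e ∣e′∣≡k = subst L (⊆-antisym e⊆e′ e′⊆e) e∈L
      where
      e⊆e′ : e ⊆ e′
      e⊆e′ = p⊆q∧∣q∣≤∣p∣⇒q⊆p e′⊆e (≤-reflexive (trans (proj₂ (L⊆G′ e e∈L)) (sym ∣e′∣≡k)))

  edges-through-S : ∀ e → (E (unionG 𝓕) e × S ⊆ e) ⇔ (S ⊎L L) e
  edges-through-S e = mk⇔ to′ from′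
    where
    to′ : E (unionG 𝓕) e × S ⊆ e → (S ⊎L L) e
    to′ ((q , e∈) , S⊆e) = e ─ S , e─S∈L , sym (p⊆q⇒p∪[q─p]≡q S⊆e)
      where
      e─S∈G′[L] : E (level k (restrict k G′ L)) (e ─ S)
      e─S∈G′[L] = proj₁ (proj₂ packing′) q (e ─ S) (edge─S q e e∈ S⊆e)
      e─S∈L : L (e ─ S)
      e─S∈L = proj₂ (proj₁ e─S∈G′[L]) (e ─ S) ⊆-refl (proj₂ e─S∈G′[L])
    from′ : (S ⊎L L) e → E (unionG 𝓕) e × S ⊆ e
    from′ (e′ , e′∈L , refl) with L-covered e′ e′∈L
    ... | q , e′∈q =
      (q , proj₂ (from (link-edges q e′) e′∈q)) , p⊆p∪q e′

∈-unionG : ∀ (𝓕 : Fin p → HG n) → x ∈ V (unionG 𝓕) ⇔ (∃ λ q → x ∈ V (𝓕 q))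
∈-unionG {p} 𝓕 = mk⇔ (∈⋃-map⁻ (V ∘ 𝓕) (allFin p))
                     (λ (q , x∈) → ∈⋃-map⁺ (V ∘ 𝓕) (∈-allFin q) x∈)

unionG-IsPhiGraph : ∀ {S₁ : Subset n} {φ} {𝓕₁ 𝓕₂ : Fin p → HG n} →
                    (∀ q → IsPhiGraph S₁ φ (𝓕₁ q) (𝓕₂ q)) →
                    IsPhiGraph S₁ φ (unionG 𝓕₁) (unionG 𝓕₂)
unionG-IsPhiGraph {n = n} {S₁ = S₁} {φ} {𝓕₁} {𝓕₂} φ-members = V-image , E-image
  where
  U₁ U₂ : Subset n
  U₁ = V (unionG 𝓕₁)
  U₂ = V (unionG 𝓕₂)
  V-image : IsPhiSet S₁ φ U₁ U₂
  V-image y = mk⇔ to′ from′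
    where
    in₁ : ∀ q {x} → x ∈ V (𝓕₁ q) → x ∈ U₁
    in₁ q x∈ = from (∈-unionG 𝓕₁) (q , x∈)
    to′ : y ∈ U₂ → (y ∈ U₁ × y ∉ S₁) ⊎ (∃ λ x → x ∈ U₁ × x ∈ S₁ × φ x ≡ y)
    to′ y∈ with to (∈-unionG 𝓕₂) y∈
    ... | q , y∈q with to (proj₁ (φ-members q) y) y∈q
    ...   | inj₁ (y∈q₁ , y∉S₁) = inj₁ (in₁ q y∈q₁ , y∉S₁)
    ...   | inj₂ (x , x∈q₁ , x∈S₁ , φx≡y) = inj₂ (x , in₁ q x∈q₁ , x∈S₁ , φx≡y)
    from′ : (y ∈ U₁ × y ∉ S₁) ⊎ (∃ λ x → x ∈ U₁ × x ∈ S₁ × φ x ≡ y) → y ∈ U₂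
    from′ (inj₁ (y∈ , y∉S₁)) with to (∈-unionG 𝓕₁) y∈
    ... | q , y∈q =
      from (∈-unionG 𝓕₂) (q , from (proj₁ (φ-members q) y) (inj₁ (y∈q , y∉S₁)))
    from′ (inj₂ (x , x∈ , x∈S₁ , φx≡y)) with to (∈-unionG 𝓕₁) x∈
    ... | q , x∈q =
      from (∈-unionG 𝓕₂) (q , from (proj₁ (φ-members q) y) (inj₂ (x , x∈q , x∈S₁ , φx≡y)))
  E-image : ∀ e → E (unionG 𝓕₂) e ⇔ (∃ λ e′ → E (unionG 𝓕₁) e′ × IsPhiSet S₁ φ e′ e)
  E-image e = mk⇔ to′ from′
    where
    to′ : E (unionG 𝓕₂) e → ∃ λ e′ → E (unionG 𝓕₁) e′ × IsPhiSet S₁ φ e′ e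
    to′ (q , e∈q) with to (proj₂ (φ-members q) e) e∈q
    ... | e′ , e′∈q , φe′≡e = e′ , (q , e′∈q) , φe′≡e
    from′ : (∃ λ e′ → E (unionG 𝓕₁) e′ × IsPhiSet S₁ φ e′ e) → E (unionG 𝓕₂) e
    from′ (e′ , (q , e′∈q) , φe′≡e) = q , from (proj₂ (φ-members q) e) (e′ , e′∈q , φe′≡e)

proposition7p9 :
    ∀ {m n p} (r i κ : ℕ) (F : HG m) (S* : Subset m) (G : HG n)
      (S₁ S₂ : Subset n) (φ : Fin n → Fin n) (L : Subset n → Set)
      (𝓕′ 𝓕₁ 𝓕₂ : Fin p → HG n) →
    IsKGraph r F → 1 ≤ i → i < r →
    S* ⊆ V F → ∣ S* ∣ ≡ i → (∃ λ e → E (link F S*) e) →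
    IsComplex G →
    S₁ ⊆ V G → ∣ S₁ ∣ ≡ i → S₂ ⊆ V G → ∣ S₂ ∣ ≡ i → Empty (S₁ ∩ S₂) →
    IsBijOn S₁ S₂ φ →
    (∀ e → L e → E (level (r ∸ i) (link G S₁)) e × E (level (r ∸ i) (link G S₂)) e) →
    IsDecomposition (r ∸ i) (link F S*) (restrict (r ∸ i) (link G S₁ ∩G link G S₂) L) 𝓕′ →
    KWellSep κ (r ∸ i) 𝓕′ →
    IsTriangle F S₁ S₂ φ 𝓕′ 𝓕₁ 𝓕₂ →
    ((IsPacking r F G 𝓕₁ × KWellSep κ r 𝓕₁ ×
       (∀ e → (E (unionG 𝓕₁) e × S₁ ⊆ e) ⇔ (S₁ ⊎L L) e)) ×
     (IsPacking r F G 𝓕₂ × KWellSep κ r 𝓕₂ ×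
       (∀ e → (E (unionG 𝓕₂) e × S₂ ⊆ e) ⇔ (S₂ ⊎L L) e))) ×
    (V (unionG 𝓕₁) ⊆ (V G ─ S₂) × IsPhiGraph S₁ φ (unionG 𝓕₁) (unionG 𝓕₂))
proposition7p9 {n = n} r i κ F S* G S₁ S₂ φ L 𝓕′ 𝓕₁ 𝓕₂ F-graph _ i<r _ _ _ G-complex
  S₁⊆V ∣S₁∣≡i _ ∣S₂∣≡i S₁∩S₂-empty _ L⊆links decomposition separated triangle =
    ( (side₁.packing , side₁.k-well-separated , side₁.edges-through-S)
    , (side₂.packing , side₂.k-well-separated , side₂.edges-through-S) )
  , ( unionG-V⊆V─S₂
    , unionG-IsPhiGraph (λ q → proj₂ (proj₂ (triangle q))) )
  where
  G′ : HG n
  G′ = link G S₁ ∩G link G S₂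
  L⊆G′ : ∀ e → L e → E G′ e × ∣ e ∣ ≡ r ∸ i
  L⊆G′ e e∈L = let ((e∈₁ , ∣e∣≡k) , (e∈₂ , _)) = L⊆links e e∈L in (e∈₁ , e∈₂) , ∣e∣≡k
  module side₁ = Extension {G′ = G′} F-graph i<r G-complex ∣S₁∣≡i (λ _ → proj₁) L⊆G′
                   decomposition separated (λ q → proj₁ (triangle q))
  module side₂ = Extension {G′ = G′} F-graph i<r G-complex ∣S₂∣≡i (λ _ → proj₂) L⊆G′
                   decomposition separated (λ q → proj₁ (proj₂ (triangle q)))
  unionG-V⊆V─S₂ : V (unionG 𝓕₁) ⊆ V G ─ S₂
  unionG-V⊆V─S₂ {y} y∈ with to (∈-unionG 𝓕₁) y∈
  ... | q , y∈q with x∈p∪q⁻ S₁ _ (⊆-reflexive (side₁.V-extends q) y∈q)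
  ...   | inj₁ y∈S₁ =
    x∈p∧x∉q⇒x∈p─q (S₁⊆V y∈S₁) (λ y∈S₂ → S₁∩S₂-empty (y , x∈p∩q⁺ (y∈S₁ , y∈S₂)))
  ...   | inj₂ y∈V′ = proj₁ (proj₂ (side₁.V′∈G′ q)) y∈V′
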